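{- A $d$-pseudomanifold $X$ is normal if and only if, for each $p$-face $x$ of $X$ with $p\le d-2$, the complex $lk(x,X)$ is a pseudomanifold.
   Context: A simplex is a non-empty finite set; its dimension is its cardinality minus one. A complex is a finite set $X$ of simplexes closed under taking non-empty subsets; elements are faces; facets are faces maximal for inclusion. A subset $S\subseteq X$ is open if $x\in S$, $y\in X$, $x\subseteq y$ imply $y\in S$. A path in a set of simplexes is a sequence of its elements with consecutive elements comparable for inclusion; a set is connected if any two elements are joined by a path in it. A $p$-pair is a pair $(x,y)$ with $x\subseteq y$, $\dim y=p$, $\dim x=p-1$; a strong $p$-path is a path whose consecutive elements form $p$-pairs in one order or the other. A set $S$ is $d$-pure if all its facets have dimension $d$; a $d$-pure $S$ is strongly connected if any two facets of $S$ are joined by a strong $d$-path in $S$. A pseudomanifold (of dimension $n$) is an $n$-pure complex that is non-branching (each $(n-1)$-face lies in exactly two $n$-faces) and strongly connected. A $d$-pseudomanifold is normal if it is connected, $d\ge1$, and every connected open subset of it is strongly connected. The link of a face $x$ of $X$ is $lk(x,X)=\{y\in X: x\cap y=\emptyset,\ x\cup y\in X\}$. -}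

module Defs where

open import Data.Nat using (ℕ; zero; suc; _≤_)
open import Data.Bool using (Bool; true; false; _∧_; not)
open import Data.Vec using (Vec; []; _∷_)
open import Data.Fin using (Fin)
open import Data.Fin.Subset using (Subset; _⊆_; _∩_; _∪_; ∣_∣; Nonempty)
open import Data.Product using (_×_; ∃; Σ)
open import Data.Sum using (_⊎_)
open import Relation.Binary.PropositionalEquality using (_≡_; _≢_)

-- Vertices are Fin n (every finite complex can be relabelled this way).
-- A simplex is a (non-empty) subset of the vertex set: Subset n.
-- A set of simplexes is a (decidable) predicate on Subset n; it is
-- automatically finite since Subset n is finite.
SSet : ℕ → Set
SSet n = Subset n → Bool

infix 4 _∈ₛ_
_∈ₛ_ : ∀ {n} → Subset n → SSet n → Set
x ∈ₛ S = S x ≡ true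

_⊆ₛ_ : ∀ {n} → SSet n → SSet n → Set
S ⊆ₛ T = ∀ x → x ∈ₛ S → x ∈ₛ T

-- dim x = p  is encoded as  ∣ x ∣ ≡ suc p.

IsComplex : ∀ {n} → SSet n → Set
IsComplex {n} X =
  (∀ x → x ∈ₛ X → Nonempty x) ×
  (∀ (x y : Subset n) → x ∈ₛ X → Nonempty y → y ⊆ x → y ∈ₛ X)

IsOpenIn : ∀ {n} → SSet n → SSet n → Set
IsOpenIn {n} X S =
  S ⊆ₛ X × (∀ (x y : Subset n) → x ∈ₛ S → y ∈ₛ X → x ⊆ y → y ∈ₛ S)

data Path {n} (S : SSet n) (R : Subset n → Subset n → Set) :
     Subset n → Subset n → Set where
  here  : ∀ {x} → x ∈ₛ S → Path S R x x
  there : ∀ {x y z} → x ∈ₛ S → R x y → Path S R y z → Path S R x z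

Comparable : ∀ {n} → Subset n → Subset n → Set
Comparable x y = x ⊆ y ⊎ y ⊆ x

Connected : ∀ {n} → SSet n → Set
Connected S = ∀ x y → x ∈ₛ S → y ∈ₛ S → Path S Comparable x y

PPair : ∀ {n} → ℕ → Subset n → Subset n → Set
PPair p x y = x ⊆ y × ∣ x ∣ ≡ p × ∣ y ∣ ≡ suc p

StrongStep : ∀ {n} → ℕ → Subset n → Subset n → Set
StrongStep p x y = PPair p x y ⊎ PPair p y x

IsFacet : ∀ {n} → SSet n → Subset n → Set
IsFacet S x = x ∈ₛ S × (∀ y → y ∈ₛ S → x ⊆ y → y ≡ x)

IsPure : ∀ {n} → ℕ → SSet n → Set
IsPure d S = ∀ x → IsFacet S x → ∣ x ∣ ≡ suc d

StronglyConnected : ∀ {n} → ℕ → SSet n → Set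
StronglyConnected d S =
  IsPure d S × (∀ x y → IsFacet S x → IsFacet S y → Path S (StrongStep d) x y)

NonBranching : ∀ {n} → ℕ → SSet n → Set
NonBranching {n} d X =
  ∀ (x : Subset n) → x ∈ₛ X → ∣ x ∣ ≡ d →
    ∃ λ (y₁ : Subset n) → ∃ λ (y₂ : Subset n) →
      y₁ ≢ y₂ ×
      (y₁ ∈ₛ X × ∣ y₁ ∣ ≡ suc d × x ⊆ y₁) ×
      (y₂ ∈ₛ X × ∣ y₂ ∣ ≡ suc d × x ⊆ y₂) ×
      (∀ z → z ∈ₛ X → ∣ z ∣ ≡ suc d → x ⊆ z → z ≡ y₁ ⊎ z ≡ y₂)

IsPseudomanifold : ∀ {n} → ℕ → SSet n → Set
IsPseudomanifold d X =
  IsComplex X × IsPure d X × NonBranching d X × StronglyConnected d X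

IsPseudomanifold′ : ∀ {n} → SSet n → Set
IsPseudomanifold′ X = ∃ λ d → IsPseudomanifold d X

IsNormal : ∀ {n} → ℕ → SSet n → Set
IsNormal {n} d X =
  IsPseudomanifold d X × Connected X × 1 ≤ d ×
  (∀ (S : SSet n) → IsOpenIn X S → Connected S → StronglyConnected d S)

disjointᵇ : ∀ {n} → Subset n → Subset n → Bool
disjointᵇ [] [] = true
disjointᵇ (a ∷ x) (b ∷ y) = not (a ∧ b) ∧ disjointᵇ x y

link : ∀ {n} → Subset n → SSet n → SSet n
link x X y = X y ∧ disjointᵇ x y ∧ X (x ∪ y)

-- Adding w to, and removing w from, faces identifies lk(w,X) with the faces of the
-- star of w that strictly contain w, shifting sizes by |w| and matching facets, strong
-- paths and the non-branching condition. The star of a face is a connected open set, so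
-- in a normal pseudomanifold every link of a face of codimension at least 2 is a strongly
-- connected pseudomanifold. Conversely, if those links are pseudomanifolds, any two facets
-- containing a face w are strongly joined inside the star of w: through the link, or
-- directly when w has codimension at most 1. A path of comparable faces in a connected
-- open set S then becomes a strong path: choose a facet above each face and join
-- consecutive facets inside the star of the smaller face, which S contains.
module Submission where

open import Defs
open import Data.Nat using (ℕ; zero; suc; _+_; _≤_; _<_; z≤n; s≤s; z<s)
open import Data.Nat.Properties
open import Data.Bool using (true; false; _∧_)
open import Data.Bool.Properties using () renaming (_≟_ to _≟ᵇ_)
open import Data.Fin using (zero; suc)
open import Data.Vec using ([]; _∷_; here; there)
open import Data.Vec.Properties using (≡-dec)
open import Data.Fin.Subset using (Subset; _⊆_; _∪_; _─_; ∣_∣; Nonempty; _∈_; _∉_)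
open import Data.Fin.Subset.Properties
  using (drop-∷-⊆; out⊆; in⊆in; _⊆?_; ⊆-refl; ⊆-trans; p⊆q⇒∣p∣≤∣q∣; ∣p∣≤n;
         p⊆p∪q; q⊆p∪q; x∈p∪q⁻; x∈p∪q⁺; p─q⊆p; x∈p∧x∉q⇒x∈p─q; anySubset?)
open import Data.Product as Prod using (∃-syntax; _×_; _,_; proj₁; proj₂)
open import Data.Sum as Sum using (inj₁; inj₂)
open import Data.Empty using (⊥-elim)
open import Relation.Nullary using (¬_; Dec; yes; no; contradiction)
open import Relation.Nullary.Decidable using (⌊_⌋; _×-dec_; ¬?; decidable-stable)
open import Relation.Binary using (tri<; tri≈; tri>)
open import Relation.Binary.PropositionalEquality
open import Function.Bundles using (_⇔_; mk⇔)

private variable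
  n : ℕ

∧-≡-true⁻ : ∀ {a b} → a ∧ b ≡ true → a ≡ true × b ≡ true
∧-≡-true⁻ {true} {true} refl = refl , refl

∧-≡-true⁺ : ∀ {a b} → a ≡ true → b ≡ true → a ∧ b ≡ true
∧-≡-true⁺ refl refl = refl

isYes-≡-true⁺ : ∀ {P : Set} (P? : Dec P) → P → ⌊ P? ⌋ ≡ true
isYes-≡-true⁺ (yes _) _ = refl
isYes-≡-true⁺ (no ¬p) p = contradiction p ¬p

isYes-≡-true⁻ : ∀ {P : Set} (P? : Dec P) → ⌊ P? ⌋ ≡ true → P
isYes-≡-true⁻ (yes p) _ = p

Disjoint : Subset n → Subset n → Set
Disjoint p q = disjointᵇ p q ≡ true

in⊈out : {p q : Subset n} → ¬ (true ∷ p ⊆ false ∷ q)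
in⊈out p⊆q with p⊆q here
... | ()

∪-monoʳ-⊆ : (p : Subset n) {q r : Subset n} → q ⊆ r → p ∪ q ⊆ p ∪ r
∪-monoʳ-⊆ p {q} q⊆r x∈p∪q = x∈p∪q⁺ (Sum.map₂ q⊆r (x∈p∪q⁻ p q x∈p∪q))

─-monoˡ-⊆ : {p q : Subset n} (r : Subset n) → p ⊆ q → p ─ r ⊆ q ─ r
─-monoˡ-⊆ {p = []} {[]} [] _ ()
─-monoˡ-⊆ {p = a ∷ p} {b ∷ q} (true ∷ r) p⊆q = out⊆ (─-monoˡ-⊆ r (drop-∷-⊆ p⊆q))
─-monoˡ-⊆ {p = false ∷ p} {b ∷ q} (false ∷ r) p⊆q = out⊆ (─-monoˡ-⊆ r (drop-∷-⊆ p⊆q))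
─-monoˡ-⊆ {p = true ∷ p} {true ∷ q} (false ∷ r) p⊆q = in⊆in (─-monoˡ-⊆ r (drop-∷-⊆ p⊆q))
─-monoˡ-⊆ {p = true ∷ p} {false ∷ q} (false ∷ r) p⊆q = ⊥-elim (in⊈out p⊆q)

p⊆q∧∣q∣≤∣p∣⇒p≡q : (p q : Subset n) → p ⊆ q → ∣ q ∣ ≤ ∣ p ∣ → p ≡ q
p⊆q∧∣q∣≤∣p∣⇒p≡q [] [] _ _ = refl
p⊆q∧∣q∣≤∣p∣⇒p≡q (false ∷ p) (false ∷ q) p⊆q ∣q∣≤∣p∣ =
  cong (false ∷_) (p⊆q∧∣q∣≤∣p∣⇒p≡q p q (drop-∷-⊆ p⊆q) ∣q∣≤∣p∣)
p⊆q∧∣q∣≤∣p∣⇒p≡q (true ∷ p) (true ∷ q) p⊆q (s≤s ∣q∣≤∣p∣) =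
  cong (true ∷_) (p⊆q∧∣q∣≤∣p∣⇒p≡q p q (drop-∷-⊆ p⊆q) ∣q∣≤∣p∣)
p⊆q∧∣q∣≤∣p∣⇒p≡q (false ∷ p) (true ∷ q) p⊆q ∣q∣<∣p∣ =
  contradiction (p⊆q⇒∣p∣≤∣q∣ (drop-∷-⊆ p⊆q)) (<⇒≱ ∣q∣<∣p∣)
p⊆q∧∣q∣≤∣p∣⇒p≡q (true ∷ p) (false ∷ q) p⊆q _ = ⊥-elim (in⊈out p⊆q)

p⊆q∧q≢p⇒∣p∣<∣q∣ : (p q : Subset n) → p ⊆ q → q ≢ p → ∣ p ∣ < ∣ q ∣
p⊆q∧q≢p⇒∣p∣<∣q∣ p q p⊆q q≢p = ≰⇒> (λ ∣q∣≤∣p∣ → q≢p (sym (p⊆q∧∣q∣≤∣p∣⇒p≡q p q p⊆q ∣q∣≤∣p∣)))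

Nonempty⇒∣p∣>0 : {p : Subset n} → Nonempty p → 0 < ∣ p ∣
Nonempty⇒∣p∣>0 {p = true ∷ p} _ = s≤s z≤n
Nonempty⇒∣p∣>0 {p = false ∷ p} (suc x , there x∈p) = Nonempty⇒∣p∣>0 (x , x∈p)

∣p∣>0⇒Nonempty : (p : Subset n) → 0 < ∣ p ∣ → Nonempty p
∣p∣>0⇒Nonempty (true ∷ p) _ = zero , here
∣p∣>0⇒Nonempty (false ∷ p) ∣p∣>0 = Prod.map suc there (∣p∣>0⇒Nonempty p ∣p∣>0)

disjoint⇒∉ : {p q : Subset n} → Disjoint p q → ∀ {x} → x ∈ p → x ∉ q
disjoint⇒∉ {p = true ∷ p} {true ∷ q} () here here
disjoint⇒∉ {p = a ∷ p} {b ∷ q} p#q (there x∈p) (there x∈q) =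
  disjoint⇒∉ (proj₂ (∧-≡-true⁻ p#q)) x∈p x∈q

disjoint-antimonoʳ : (p : Subset n) {q r : Subset n} → r ⊆ q → Disjoint p q → Disjoint p r
disjoint-antimonoʳ [] {[]} {[]} _ _ = refl
disjoint-antimonoʳ (false ∷ p) {b ∷ q} {c ∷ r} r⊆q p#q = disjoint-antimonoʳ p (drop-∷-⊆ r⊆q) p#q
disjoint-antimonoʳ (true ∷ p) {false ∷ q} {false ∷ r} r⊆q p#q = disjoint-antimonoʳ p (drop-∷-⊆ r⊆q) p#q
disjoint-antimonoʳ (true ∷ p) {false ∷ q} {true ∷ r} r⊆q p#q = ⊥-elim (in⊈out r⊆q)

disjoint-p[q─p] : (p q : Subset n) → Disjoint p (q ─ p)
disjoint-p[q─p] [] [] = refl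
disjoint-p[q─p] (false ∷ p) (b ∷ q) = disjoint-p[q─p] p q
disjoint-p[q─p] (true ∷ p) (b ∷ q) = disjoint-p[q─p] p q

∣p∪q∣≡∣p∣+∣q∣ : (p q : Subset n) → Disjoint p q → ∣ p ∪ q ∣ ≡ ∣ p ∣ + ∣ q ∣
∣p∪q∣≡∣p∣+∣q∣ [] [] _ = refl
∣p∪q∣≡∣p∣+∣q∣ (false ∷ p) (false ∷ q) p#q = ∣p∪q∣≡∣p∣+∣q∣ p q p#q
∣p∪q∣≡∣p∣+∣q∣ (false ∷ p) (true ∷ q) p#q =
  trans (cong suc (∣p∪q∣≡∣p∣+∣q∣ p q p#q)) (sym (+-suc ∣ p ∣ ∣ q ∣))
∣p∪q∣≡∣p∣+∣q∣ (true ∷ p) (false ∷ q) p#q = cong suc (∣p∪q∣≡∣p∣+∣q∣ p q p#q)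

p∪q─p≡q : (p q : Subset n) → Disjoint p q → p ∪ q ─ p ≡ q
p∪q─p≡q [] [] _ = refl
p∪q─p≡q (false ∷ p) (b ∷ q) p#q = cong (b ∷_) (p∪q─p≡q p q p#q)
p∪q─p≡q (true ∷ p) (false ∷ q) p#q = cong (false ∷_) (p∪q─p≡q p q p#q)

p⊆q⇒p∪[q─p]≡q : (p q : Subset n) → p ⊆ q → p ∪ (q ─ p) ≡ q
p⊆q⇒p∪[q─p]≡q [] [] _ = refl
p⊆q⇒p∪[q─p]≡q (false ∷ p) (b ∷ q) p⊆q = cong (b ∷_) (p⊆q⇒p∪[q─p]≡q p q (drop-∷-⊆ p⊆q))
p⊆q⇒p∪[q─p]≡q (true ∷ p) (true ∷ q) p⊆q = cong (true ∷_) (p⊆q⇒p∪[q─p]≡q p q (drop-∷-⊆ p⊆q))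
p⊆q⇒p∪[q─p]≡q (true ∷ p) (false ∷ q) p⊆q = ⊥-elim (in⊈out p⊆q)

─-cancelʳ : {p q r : Subset n} → p ⊆ q → p ⊆ r → q ─ p ≡ r ─ p → q ≡ r
─-cancelʳ {p = p} {q} {r} p⊆q p⊆r q─p≡r─p = begin
  q            ≡⟨ p⊆q⇒p∪[q─p]≡q p q p⊆q ⟨
  p ∪ (q ─ p)  ≡⟨ cong (p ∪_) q─p≡r─p ⟩
  p ∪ (r ─ p)  ≡⟨ p⊆q⇒p∪[q─p]≡q p r p⊆r ⟩
  r            ∎
  where open ≡-Reasoning

p⊆q⇒∣p∣+∣q─p∣≡∣q∣ : (p q : Subset n) → p ⊆ q → ∣ p ∣ + ∣ q ─ p ∣ ≡ ∣ q ∣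
p⊆q⇒∣p∣+∣q─p∣≡∣q∣ p q p⊆q = begin
  ∣ p ∣ + ∣ q ─ p ∣  ≡⟨ ∣p∪q∣≡∣p∣+∣q∣ p (q ─ p) (disjoint-p[q─p] p q) ⟨
  ∣ p ∪ (q ─ p) ∣    ≡⟨ cong ∣_∣ (p⊆q⇒p∪[q─p]≡q p q p⊆q) ⟩
  ∣ q ∣              ∎
  where open ≡-Reasoning

p⊆q∧∣p∣<∣q∣⇒Nonempty[q─p] : (p q : Subset n) → p ⊆ q → ∣ p ∣ < ∣ q ∣ → Nonempty (q ─ p)
p⊆q∧∣p∣<∣q∣⇒Nonempty[q─p] p q p⊆q ∣p∣<∣q∣ = ∣p∣>0⇒Nonempty (q ─ p) (+-cancelˡ-< (∣ p ∣) 0 _ (begin-strict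
  ∣ p ∣ + 0          ≡⟨ +-identityʳ ∣ p ∣ ⟩
  ∣ p ∣              <⟨ ∣p∣<∣q∣ ⟩
  ∣ q ∣              ≡⟨ p⊆q⇒∣p∣+∣q─p∣≡∣q∣ p q p⊆q ⟨
  ∣ p ∣ + ∣ q ─ p ∣  ∎))
  where open ≤-Reasoning

p∪q⊆r⇒q⊆r─p : (p q : Subset n) {r : Subset n} → Disjoint p q → p ∪ q ⊆ r → q ⊆ r ─ p
p∪q⊆r⇒q⊆r─p p q p#q p∪q⊆r x∈q =
  x∈p∧x∉q⇒x∈p─q (p∪q⊆r (q⊆p∪q p q x∈q)) (λ x∈p → disjoint⇒∉ p#q x∈p x∈q)

module _ {S : SSet n} {R : Subset n → Subset n → Set} where

  Path-start : ∀ {a b} → Path S R a b → a ∈ₛ S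
  Path-start (here a∈S) = a∈S
  Path-start (there a∈S _ _) = a∈S

  infixr 5 _++ₚ_
  _++ₚ_ : ∀ {a b c} → Path S R a b → Path S R b c → Path S R a c
  here _ ++ₚ q = q
  there a∈S r p ++ₚ q = there a∈S r (p ++ₚ q)

  Path-mono : ∀ {T a b} → S ⊆ₛ T → Path S R a b → Path T R a b
  Path-mono S⊆T (here a∈S) = here (S⊆T _ a∈S)
  Path-mono S⊆T (there a∈S r p) = there (S⊆T _ a∈S) r (Path-mono S⊆T p)

  Path-map : ∀ {R′ a b} → (∀ {u v} → R u v → R′ u v) → Path S R a b → Path S R′ a b
  Path-map f (here a∈S) = here a∈S
  Path-map f (there a∈S r p) = there a∈S (f r) (Path-map f p)

StrongStep⇒Comparable : ∀ {d} {u v : Subset n} → StrongStep d u v → Comparable u v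
StrongStep⇒Comparable = Sum.map proj₁ proj₁

module _ (X : SSet n) where

  private
    StrictlyAbove : Subset n → Subset n → Set
    StrictlyAbove z y = y ∈ₛ X × z ⊆ y × y ≢ z

    strictlyAbove? : ∀ z y → Dec (StrictlyAbove z y)
    strictlyAbove? z y = (X y ≟ᵇ true) ×-dec (z ⊆? y) ×-dec ¬? (≡-dec _≟ᵇ_ y z)

    -- Fuel: at most k vertices can still be added to z.
    facet-above′ : ∀ k z → z ∈ₛ X → n ≤ ∣ z ∣ + k → ∃[ F ] IsFacet X F × z ⊆ F
    facet-above′ k z z∈X n≤∣z∣+k with anySubset? (strictlyAbove? z)
    ... | no nothingAbove = z , (z∈X , maximal) , ⊆-refl
      where
      maximal : ∀ y → y ∈ₛ X → z ⊆ y → y ≡ z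
      maximal y y∈X z⊆y = decidable-stable (≡-dec _≟ᵇ_ y z) (λ y≢z → nothingAbove (y , y∈X , z⊆y , y≢z))
    facet-above′ zero z _ n≤∣z∣ | yes (y , _ , z⊆y , y≢z) =
      contradiction (≤-trans (∣p∣≤n y) (≤-trans n≤∣z∣ (≤-reflexive (+-identityʳ ∣ z ∣))))
                    (<⇒≱ (p⊆q∧q≢p⇒∣p∣<∣q∣ z y z⊆y y≢z))
    facet-above′ (suc k) z _ n≤∣z∣+1+k | yes (y , y∈X , z⊆y , y≢z) =
      let F , F-facet , y⊆F = facet-above′ k y y∈X n≤∣y∣+k in F , F-facet , ⊆-trans z⊆y y⊆F
      where
      n≤∣y∣+k : n ≤ ∣ y ∣ + k
      n≤∣y∣+k = ≤-trans n≤∣z∣+1+k (≤-trans (≤-reflexive (+-suc ∣ z ∣ k))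
                                           (+-monoˡ-≤ k (p⊆q∧q≢p⇒∣p∣<∣q∣ z y z⊆y y≢z)))

  facet-above : ∀ {z} → z ∈ₛ X → ∃[ F ] IsFacet X F × z ⊆ F
  facet-above {z} z∈X = facet-above′ n z z∈X (m≤n+m n ∣ z ∣)

facet-of-⊆ : {S X : SSet n} {F : Subset n} → S ⊆ₛ X → IsFacet X F → F ∈ₛ S → IsFacet S F
facet-of-⊆ S⊆X (_ , maximal) F∈S = F∈S , λ y y∈S → maximal y (S⊆X y y∈S)

facet-of-open : {S X : SSet n} {F : Subset n} → IsOpenIn X S → IsFacet S F → IsFacet X F
facet-of-open (S⊆X , upward) (F∈S , maximal) =
  S⊆X _ F∈S , λ y y∈X F⊆y → maximal y (upward _ y F∈S y∈X F⊆y) F⊆y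

star : Subset n → SSet n → SSet n
star w X y = X y ∧ ⌊ w ⊆? y ⌋

module StarLink (X : SSet n) (w : Subset n) where

  ∈-star⁺ : ∀ {y} → y ∈ₛ X → w ⊆ y → y ∈ₛ star w X
  ∈-star⁺ {y} y∈X w⊆y = ∧-≡-true⁺ y∈X (isYes-≡-true⁺ (w ⊆? y) w⊆y)

  ∈-star⇒∈ : ∀ {y} → y ∈ₛ star w X → y ∈ₛ X
  ∈-star⇒∈ {y} y∈st = proj₁ (∧-≡-true⁻ {X y} y∈st)

  ∈-star⇒⊇ : ∀ {y} → y ∈ₛ star w X → w ⊆ y
  ∈-star⇒⊇ {y} y∈st = isYes-≡-true⁻ (w ⊆? y) (proj₂ (∧-≡-true⁻ {X y} y∈st))

  star-isOpen : IsOpenIn X (star w X)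
  star-isOpen = (λ _ → ∈-star⇒∈) , λ u v u∈st v∈X u⊆v → ∈-star⁺ v∈X (⊆-trans (∈-star⇒⊇ u∈st) u⊆v)

  star-connected : w ∈ₛ X → Connected (star w X)
  star-connected w∈X u v u∈st v∈st =
    there u∈st (inj₂ (∈-star⇒⊇ u∈st)) (there (∈-star⁺ w∈X ⊆-refl) (inj₁ (∈-star⇒⊇ v∈st)) (here v∈st))

  ∈-link⁺ : ∀ {y} → y ∈ₛ X → Disjoint w y → w ∪ y ∈ₛ X → y ∈ₛ link w X
  ∈-link⁺ y∈X w#y w∪y∈X = ∧-≡-true⁺ y∈X (∧-≡-true⁺ w#y w∪y∈X)

  ∈-link⇒∈ : ∀ {y} → y ∈ₛ link w X → y ∈ₛ X
  ∈-link⇒∈ {y} y∈lk = proj₁ (∧-≡-true⁻ {X y} y∈lk)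

  ∈-link⇒disjoint : ∀ {y} → y ∈ₛ link w X → Disjoint w y
  ∈-link⇒disjoint {y} y∈lk = proj₁ (∧-≡-true⁻ {disjointᵇ w y} (proj₂ (∧-≡-true⁻ {X y} y∈lk)))

  ∈-link⇒∪∈ : ∀ {y} → y ∈ₛ link w X → w ∪ y ∈ₛ X
  ∈-link⇒∪∈ {y} y∈lk = proj₂ (∧-≡-true⁻ {disjointᵇ w y} (proj₂ (∧-≡-true⁻ {X y} y∈lk)))

  star-⊆-open : ∀ {S} → IsOpenIn X S → w ∈ₛ S → star w X ⊆ₛ S
  star-⊆-open (_ , upward) w∈S y y∈st = upward w y w∈S (∈-star⇒∈ y∈st) (∈-star⇒⊇ y∈st)

  ∪-∈-star : ∀ {y} → y ∈ₛ link w X → w ∪ y ∈ₛ star w X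
  ∪-∈-star {y} y∈lk = ∈-star⁺ (∈-link⇒∪∈ y∈lk) (p⊆p∪q y)

module _ (w : Subset n) {e : ℕ} {u v : Subset n} where

  PPair-∪ : Disjoint w u → Disjoint w v → PPair e u v → PPair (∣ w ∣ + e) (w ∪ u) (w ∪ v)
  PPair-∪ w#u w#v (u⊆v , ∣u∣≡e , ∣v∣≡1+e) =
    ∪-monoʳ-⊆ w u⊆v ,
    trans (∣p∪q∣≡∣p∣+∣q∣ w u w#u) (cong (∣ w ∣ +_) ∣u∣≡e) ,
    trans (∣p∪q∣≡∣p∣+∣q∣ w v w#v) (trans (cong (∣ w ∣ +_) ∣v∣≡1+e) (+-suc ∣ w ∣ e))

  PPair-─ : w ⊆ u → w ⊆ v → PPair (∣ w ∣ + e) u v → PPair e (u ─ w) (v ─ w)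
  PPair-─ w⊆u w⊆v (u⊆v , ∣u∣≡∣w∣+e , ∣v∣≡1+∣w∣+e) =
    ─-monoˡ-⊆ w u⊆v ,
    +-cancelˡ-≡ (∣ w ∣) _ _ (trans (p⊆q⇒∣p∣+∣q─p∣≡∣q∣ w u w⊆u) ∣u∣≡∣w∣+e) ,
    +-cancelˡ-≡ (∣ w ∣) _ _ (trans (p⊆q⇒∣p∣+∣q─p∣≡∣q∣ w v w⊆v) (trans ∣v∣≡1+∣w∣+e (sym (+-suc ∣ w ∣ e))))

module _ {X : SSet n} {w : Subset n} where
  open StarLink X w

  strongPath-link⇒star : ∀ {e a b} → Path (link w X) (StrongStep e) a b →
                         Path (star w X) (StrongStep (∣ w ∣ + e)) (w ∪ a) (w ∪ b)
  strongPath-link⇒star (here a∈lk) = here (∪-∈-star a∈lk)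
  strongPath-link⇒star {a = a} (there {y = a′} a∈lk step p) =
    there (∪-∈-star a∈lk) (Sum.map (PPair-∪ w w#a w#a′) (PPair-∪ w w#a′ w#a) step) (strongPath-link⇒star p)
    where
    w#a : Disjoint w a
    w#a = ∈-link⇒disjoint a∈lk
    w#a′ : Disjoint w a′
    w#a′ = ∈-link⇒disjoint (Path-start p)

StrongStep⇒<∣u∣ : ∀ {m k} {u v : Subset n} → StrongStep (m + suc k) u v → m < ∣ u ∣
StrongStep⇒<∣u∣ {m = m} (inj₁ (_ , ∣u∣≡m+1+k , _)) = subst (m <_) (sym ∣u∣≡m+1+k) (m<m+n m z<s)
StrongStep⇒<∣u∣ {m = m} (inj₂ (_ , _ , ∣u∣≡1+m+1+k)) =
  subst (m <_) (sym ∣u∣≡1+m+1+k) (m<n⇒m<1+n (m<m+n m z<s))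

module _ {X : SSet n} (cx : IsComplex X) (w : Subset n) where
  open StarLink X w

  private
    closed : ∀ {x y} → x ∈ₛ X → Nonempty y → y ⊆ x → y ∈ₛ X
    closed {x} {y} = proj₂ cx x y

  ─-∈-link : ∀ {u} → u ∈ₛ X → w ⊆ u → Nonempty (u ─ w) → u ─ w ∈ₛ link w X
  ─-∈-link {u} u∈X w⊆u u─w≢∅ =
    ∈-link⁺ (closed u∈X u─w≢∅ (p─q⊆p u w)) (disjoint-p[q─p] w u)
            (subst (_∈ₛ X) (sym (p⊆q⇒p∪[q─p]≡q w u w⊆u)) u∈X)

  link-isComplex : IsComplex (link w X)
  link-isComplex = (λ y y∈lk → proj₁ cx y (∈-link⇒∈ y∈lk)) , λ y y′ y∈lk y′≢∅ y′⊆y →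
    ∈-link⁺ (closed (∈-link⇒∈ y∈lk) y′≢∅ y′⊆y)
            (disjoint-antimonoʳ w y′⊆y (∈-link⇒disjoint y∈lk))
            (closed (∈-link⇒∪∈ y∈lk) (Prod.map₂ (q⊆p∪q w y′) y′≢∅) (∪-monoʳ-⊆ w y′⊆y))

  link-facet⇒∪-facet : ∀ {y} → IsFacet (link w X) y → IsFacet X (w ∪ y)
  link-facet⇒∪-facet {y} (y∈lk , maximal) = ∈-link⇒∪∈ y∈lk , λ z z∈X w∪y⊆z →
    let y⊆z─w = p∪q⊆r⇒q⊆r─p w y (∈-link⇒disjoint y∈lk) w∪y⊆z
        w⊆z = ⊆-trans (p⊆p∪q y) w∪y⊆z
        z─w∈lk = ─-∈-link z∈X w⊆z (Prod.map₂ y⊆z─w (proj₁ cx y (∈-link⇒∈ y∈lk)))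
    in begin
      z            ≡⟨ p⊆q⇒p∪[q─p]≡q w z w⊆z ⟨
      w ∪ (z ─ w)  ≡⟨ cong (w ∪_) (maximal (z ─ w) z─w∈lk y⊆z─w) ⟩
      w ∪ y        ∎
    where open ≡-Reasoning

  facet⇒─-link-facet : ∀ {F} → IsFacet X F → w ⊆ F → Nonempty (F ─ w) → IsFacet (link w X) (F ─ w)
  facet⇒─-link-facet {F} (F∈X , maximal) w⊆F F─w≢∅ = ─-∈-link F∈X w⊆F F─w≢∅ , λ y y∈lk F─w⊆y →
    let F⊆w∪y = subst (_⊆ w ∪ y) (p⊆q⇒p∪[q─p]≡q w F w⊆F) (∪-monoʳ-⊆ w F─w⊆y)
    in begin
      y          ≡⟨ p∪q─p≡q w y (∈-link⇒disjoint y∈lk) ⟨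
      w ∪ y ─ w  ≡⟨ cong (_─ w) (maximal (w ∪ y) (∈-link⇒∪∈ y∈lk) F⊆w∪y) ⟩
      F ─ w      ∎
    where open ≡-Reasoning

  private
    star-─-∈-link : ∀ {u} → u ∈ₛ star w X → ∣ w ∣ < ∣ u ∣ → u ─ w ∈ₛ link w X
    star-─-∈-link {u} u∈st ∣w∣<∣u∣ =
      ─-∈-link (∈-star⇒∈ u∈st) w⊆u (p⊆q∧∣p∣<∣q∣⇒Nonempty[q─p] w u w⊆u ∣w∣<∣u∣)
      where
      w⊆u : w ⊆ u
      w⊆u = ∈-star⇒⊇ u∈st

  strongPath-star⇒link : ∀ {k a b} → Path (star w X) (StrongStep (∣ w ∣ + suc k)) a b → ∣ w ∣ < ∣ b ∣ →
                         Path (link w X) (StrongStep (suc k)) (a ─ w) (b ─ w)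
  strongPath-star⇒link (here b∈st) ∣w∣<∣b∣ = here (star-─-∈-link b∈st ∣w∣<∣b∣)
  strongPath-star⇒link {a = a} (there {y = a′} a∈st step p) ∣w∣<∣b∣ =
    there (star-─-∈-link a∈st (StrongStep⇒<∣u∣ step))
          (Sum.map (PPair-─ w w⊆a w⊆a′) (PPair-─ w w⊆a′ w⊆a) step)
          (strongPath-star⇒link p ∣w∣<∣b∣)
    where
    w⊆a : w ⊆ a
    w⊆a = ∈-star⇒⊇ a∈st
    w⊆a′ : w ⊆ a′
    w⊆a′ = ∈-star⇒⊇ (Path-start p)

0<m<d⇒∃[p]m≡1+p×p+2≤d : ∀ {m d} → 0 < m → m < d → ∃[ p ] m ≡ suc p × p + 2 ≤ d
0<m<d⇒∃[p]m≡1+p×p+2≤d {suc p} {d} _ 1+p<d = p , refl , subst (_≤ d) (+-comm 2 p) 1+p<d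

OpenSetsStronglyConnected : ℕ → SSet n → Set
OpenSetsStronglyConnected d X = ∀ S → IsOpenIn X S → Connected S → StronglyConnected d S

LinksArePseudomanifolds : ℕ → SSet n → Set
LinksArePseudomanifolds {n} d X =
  ∀ (x : Subset n) p → x ∈ₛ X → ∣ x ∣ ≡ suc p → p + 2 ≤ d → IsPseudomanifold′ (link x X)

FacetsStronglyJoinedInStars : ℕ → SSet n → Set
FacetsStronglyJoinedInStars {n} d X = ∀ {w F G : Subset n} → w ∈ₛ X → IsFacet X F → IsFacet X G →
  w ⊆ F → w ⊆ G → Path (star w X) (StrongStep d) F G

module _ {X : SSet n} {d : ℕ} (cx : IsComplex X) (w : Subset n) where
  open StarLink X w

  link-isPure : ∀ {e} → IsPure d X → ∣ w ∣ + e ≡ d → IsPure e (link w X)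
  link-isPure {e} pure ∣w∣+e≡d y y-facet = +-cancelˡ-≡ (∣ w ∣) _ _ (begin
    ∣ w ∣ + ∣ y ∣    ≡⟨ ∣p∪q∣≡∣p∣+∣q∣ w y (∈-link⇒disjoint (proj₁ y-facet)) ⟨
    ∣ w ∪ y ∣        ≡⟨ pure (w ∪ y) (link-facet⇒∪-facet cx w y-facet) ⟩
    suc d            ≡⟨ cong suc ∣w∣+e≡d ⟨
    suc (∣ w ∣ + e)  ≡⟨ +-suc ∣ w ∣ e ⟨
    ∣ w ∣ + suc e    ∎)
    where open ≡-Reasoning

  link-nonBranching : ∀ {e} → NonBranching d X → ∣ w ∣ + e ≡ d → NonBranching e (link w X)
  link-nonBranching {e} nb ∣w∣+e≡d y y∈lk ∣y∣≡e
    with nb (w ∪ y) (∈-link⇒∪∈ y∈lk)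
            (trans (∣p∪q∣≡∣p∣+∣q∣ w y (∈-link⇒disjoint y∈lk)) (trans (cong (∣ w ∣ +_) ∣y∣≡e) ∣w∣+e≡d))
  ... | y₁ , y₂ , y₁≢y₂ , (y₁∈X , ∣y₁∣≡1+d , w∪y⊆y₁) , (y₂∈X , ∣y₂∣≡1+d , w∪y⊆y₂) , only =
    y₁ ─ w , y₂ ─ w ,
    (λ eq → y₁≢y₂ (─-cancelʳ (w⊆ w∪y⊆y₁) (w⊆ w∪y⊆y₂) eq)) ,
    cofacet y₁∈X ∣y₁∣≡1+d w∪y⊆y₁ ,
    cofacet y₂∈X ∣y₂∣≡1+d w∪y⊆y₂ ,
    λ z z∈lk ∣z∣≡1+e y⊆z →
      let w#z = ∈-link⇒disjoint z∈lk
          ∣w∪z∣≡1+d = trans (∣p∪q∣≡∣p∣+∣q∣ w z w#z) (trans (cong (∣ w ∣ +_) ∣z∣≡1+e) ∣w∣+1+e≡1+d)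
      in Sum.map (λ eq → trans (sym (p∪q─p≡q w z w#z)) (cong (_─ w) eq))
                 (λ eq → trans (sym (p∪q─p≡q w z w#z)) (cong (_─ w) eq))
                 (only (w ∪ z) (∈-link⇒∪∈ z∈lk) ∣w∪z∣≡1+d (∪-monoʳ-⊆ w y⊆z))
    where
    ∣w∣+1+e≡1+d : ∣ w ∣ + suc e ≡ suc d
    ∣w∣+1+e≡1+d = trans (+-suc ∣ w ∣ e) (cong suc ∣w∣+e≡d)

    w⊆ : ∀ {u} → w ∪ y ⊆ u → w ⊆ u
    w⊆ = ⊆-trans (p⊆p∪q y)

    cofacet : ∀ {u} → u ∈ₛ X → ∣ u ∣ ≡ suc d → w ∪ y ⊆ u →
              u ─ w ∈ₛ link w X × ∣ u ─ w ∣ ≡ suc e × y ⊆ u ─ w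
    cofacet {u} u∈X ∣u∣≡1+d w∪y⊆u =
      ─-∈-link cx w u∈X (w⊆ w∪y⊆u) (Prod.map₂ y⊆u─w (proj₁ cx y (∈-link⇒∈ y∈lk))) ,
      +-cancelˡ-≡ (∣ w ∣) _ _
        (trans (p⊆q⇒∣p∣+∣q─p∣≡∣q∣ w u (w⊆ w∪y⊆u)) (trans ∣u∣≡1+d (sym ∣w∣+1+e≡1+d))) ,
      y⊆u─w
      where
      y⊆u─w : y ⊆ u ─ w
      y⊆u─w = p∪q⊆r⇒q⊆r─p w y (∈-link⇒disjoint y∈lk) w∪y⊆u

  link-stronglyConnected : ∀ {k} → IsPure d X → OpenSetsStronglyConnected d X → w ∈ₛ X →
                           ∣ w ∣ + suc k ≡ d → StronglyConnected (suc k) (link w X)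
  link-stronglyConnected {k} pure normal w∈X ∣w∣+1+k≡d =
    link-isPure pure ∣w∣+1+k≡d , λ y y′ y-facet y′-facet →
    let w#y = ∈-link⇒disjoint (proj₁ y-facet)
        w#y′ = ∈-link⇒disjoint (proj₁ y′-facet)
        in-star = proj₂ (normal (star w X) star-isOpen (star-connected w∈X)) _ _
                    (star-facet y-facet) (star-facet y′-facet)
        ∣w∣<∣w∪y′∣ = subst (∣ w ∣ <_) (sym (∣p∪q∣≡∣p∣+∣q∣ w y′ w#y′))
                       (m<m+n ∣ w ∣ (Nonempty⇒∣p∣>0 (proj₁ cx y′ (∈-link⇒∈ (proj₁ y′-facet)))))
    in subst₂ (Path (link w X) (StrongStep (suc k))) (p∪q─p≡q w y w#y) (p∪q─p≡q w y′ w#y′)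
         (strongPath-star⇒link cx w (subst (λ m → Path _ (StrongStep m) _ _) (sym ∣w∣+1+k≡d) in-star)
                                     ∣w∣<∣w∪y′∣)
    where
    star-facet : ∀ {y} → IsFacet (link w X) y → IsFacet (star w X) (w ∪ y)
    star-facet y-facet =
      facet-of-⊆ (proj₁ star-isOpen) (link-facet⇒∪-facet cx w y-facet) (∪-∈-star (proj₁ y-facet))

  link-isPseudomanifold : ∀ {k} → IsPure d X → NonBranching d X → OpenSetsStronglyConnected d X →
                          w ∈ₛ X → ∣ w ∣ + suc k ≡ d → IsPseudomanifold (suc k) (link w X)
  link-isPseudomanifold pure nb normal w∈X ∣w∣+1+k≡d =
    link-isComplex cx w , link-isPure pure ∣w∣+1+k≡d , link-nonBranching nb ∣w∣+1+k≡d ,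
    link-stronglyConnected pure normal w∈X ∣w∣+1+k≡d

normal⇒linksArePseudomanifolds : ∀ {d} {X : SSet n} → IsPseudomanifold d X → OpenSetsStronglyConnected d X →
                                 LinksArePseudomanifolds d X
normal⇒linksArePseudomanifolds {d = d} (cx , pure , nb , _) normal x p x∈X ∣x∣≡1+p p+2≤d =
  let k , 1+∣x∣+k≡d = m≤n⇒∃[o]m+o≡n ∣x∣<d
  in suc k , link-isPseudomanifold cx x pure nb normal x∈X (trans (+-suc ∣ x ∣ k) 1+∣x∣+k≡d)
  where
  ∣x∣<d : ∣ x ∣ < d
  ∣x∣<d = subst (_< d) (sym ∣x∣≡1+p) (subst (_≤ d) (+-comm p 2) p+2≤d)

module _ {X : SSet n} {d : ℕ} (cx : IsComplex X) (pure : IsPure d X) where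

  facets-joined-through-link : LinksArePseudomanifolds d X → ∀ {w F G} → w ∈ₛ X → ∣ w ∣ < d →
    IsFacet X F → IsFacet X G → w ⊆ F → w ⊆ G → Path (star w X) (StrongStep d) F G
  facets-joined-through-link links {w} {F} {G} w∈X ∣w∣<d F-facet G-facet w⊆F w⊆G
    with 0<m<d⇒∃[p]m≡1+p×p+2≤d (Nonempty⇒∣p∣>0 (proj₁ cx w w∈X)) ∣w∣<d
  ... | p , ∣w∣≡1+p , p+2≤d with links w p w∈X ∣w∣≡1+p p+2≤d
  ... | e , _ , link-pure , _ , _ , link-sc =
    subst₂ (Path (star w X) (StrongStep d)) (p⊆q⇒p∪[q─p]≡q w F w⊆F) (p⊆q⇒p∪[q─p]≡q w G w⊆G)
      (subst (λ m → Path _ (StrongStep m) _ _) ∣w∣+e≡d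
        (strongPath-link⇒star (link-sc (F ─ w) (G ─ w) (cofacet F-facet w⊆F) (cofacet G-facet w⊆G))))
    where
    cofacet : ∀ {H} → IsFacet X H → w ⊆ H → IsFacet (link w X) (H ─ w)
    cofacet {H} H-facet w⊆H = facet⇒─-link-facet cx w H-facet w⊆H
      (p⊆q∧∣p∣<∣q∣⇒Nonempty[q─p] w H w⊆H (subst (∣ w ∣ <_) (sym (pure H H-facet)) (m<n⇒m<1+n ∣w∣<d)))

    ∣w∣+e≡d : ∣ w ∣ + e ≡ d
    ∣w∣+e≡d = suc-injective (begin
      suc (∣ w ∣ + e)    ≡⟨ +-suc ∣ w ∣ e ⟨
      ∣ w ∣ + suc e      ≡⟨ cong (∣ w ∣ +_) (link-pure (F ─ w) (cofacet F-facet w⊆F)) ⟨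
      ∣ w ∣ + ∣ F ─ w ∣  ≡⟨ p⊆q⇒∣p∣+∣q─p∣≡∣q∣ w F w⊆F ⟩
      ∣ F ∣              ≡⟨ pure F F-facet ⟩
      suc d              ∎)
      where open ≡-Reasoning

  linksArePseudomanifolds⇒facetsStronglyJoinedInStars :
    LinksArePseudomanifolds d X → FacetsStronglyJoinedInStars d X
  linksArePseudomanifolds⇒facetsStronglyJoinedInStars links {w} {F} {G} w∈X F-facet G-facet w⊆F w⊆G
    with <-cmp ∣ w ∣ d
  ... | tri< ∣w∣<d _ _ = facets-joined-through-link links w∈X ∣w∣<d F-facet G-facet w⊆F w⊆G
  ... | tri≈ _ ∣w∣≡d _ =
    there F∈star (inj₂ (w⊆F , ∣w∣≡d , pure F F-facet))
      (there (∈-star⁺ w∈X ⊆-refl) (inj₁ (w⊆G , ∣w∣≡d , pure G G-facet)) (here G∈star))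
    where
    open StarLink X w
    F∈star : F ∈ₛ star w X
    F∈star = ∈-star⁺ (proj₁ F-facet) w⊆F
    G∈star : G ∈ₛ star w X
    G∈star = ∈-star⁺ (proj₁ G-facet) w⊆G
  ... | tri> _ _ d<∣w∣ =
    subst (Path (star w X) (StrongStep d) F) (trans (sym (w≡ F-facet w⊆F)) (w≡ G-facet w⊆G))
          (here (StarLink.∈-star⁺ X w (proj₁ F-facet) w⊆F))
    where
    w≡ : ∀ {H} → IsFacet X H → w ⊆ H → w ≡ H
    w≡ {H} H-facet w⊆H = p⊆q∧∣q∣≤∣p∣⇒p≡q w H w⊆H (subst (_≤ ∣ w ∣) (sym (pure H H-facet)) d<∣w∣)

module _ {X : SSet n} {d : ℕ} (pure : IsPure d X) (joined : FacetsStronglyJoinedInStars d X) where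

  facetsStronglyJoinedInStars⇒openSetsStronglyConnected : OpenSetsStronglyConnected d X
  facetsStronglyJoinedInStars⇒openSetsStronglyConnected S S-open@(S⊆X , upward) S-connected =
    (λ F F-facet → pure F (facet-of-open S-open F-facet)) ,
    λ F G F-facet G-facet → walk (S-connected F G (proj₁ F-facet) (proj₁ G-facet)) G-facet
                                 (facet-of-open S-open F-facet) ⊆-refl
    where
    joined-in-S : ∀ {w F G} → w ∈ₛ S → IsFacet X F → IsFacet X G → w ⊆ F → w ⊆ G →
                  Path S (StrongStep d) F G
    joined-in-S {w} w∈S F-facet G-facet w⊆F w⊆G =
      Path-mono (StarLink.star-⊆-open X w S-open w∈S) (joined (S⊆X w w∈S) F-facet G-facet w⊆F w⊆G)

    joined-across : ∀ {a a′ F F′} → a ∈ₛ S → a′ ∈ₛ S → Comparable a a′ → IsFacet X F → IsFacet X F′ →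
                    a ⊆ F → a′ ⊆ F′ → Path S (StrongStep d) F F′
    joined-across a∈S _ (inj₁ a⊆a′) F-facet F′-facet a⊆F a′⊆F′ =
      joined-in-S a∈S F-facet F′-facet a⊆F (⊆-trans a⊆a′ a′⊆F′)
    joined-across _ a′∈S (inj₂ a′⊆a) F-facet F′-facet a⊆F a′⊆F′ =
      joined-in-S a′∈S F-facet F′-facet (⊆-trans a′⊆a a⊆F) a′⊆F′

    walk : ∀ {a b} → Path S Comparable a b → IsFacet S b → ∀ {F} → IsFacet X F → a ⊆ F →
           Path S (StrongStep d) F b
    walk (here b∈S) (_ , maximal) {F} F-facet b⊆F =
      subst (Path S (StrongStep d) F) (maximal F F∈S b⊆F) (here F∈S)
      where
      F∈S : F ∈ₛ S
      F∈S = upward _ F b∈S (proj₁ F-facet) b⊆F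
    walk (there a∈S a~a′ p) b-facet F-facet a⊆F =
      let a′∈S = Path-start p
          F′ , F′-facet , a′⊆F′ = facet-above X (S⊆X _ a′∈S)
      in joined-across a∈S a′∈S a~a′ F-facet F′-facet a⊆F a′⊆F′ ++ₚ walk p b-facet F′-facet a′⊆F′

stronglyConnected⇒connected : ∀ {d} {X : SSet n} → StronglyConnected d X → Connected X
stronglyConnected⇒connected {X = X} (_ , facets-joined) u v u∈X v∈X =
  let Fᵤ , Fᵤ-facet , u⊆Fᵤ = facet-above X u∈X
      Fᵥ , Fᵥ-facet , v⊆Fᵥ = facet-above X v∈X
  in there u∈X (inj₁ u⊆Fᵤ) (Path-map StrongStep⇒Comparable (facets-joined Fᵤ Fᵥ Fᵤ-facet Fᵥ-facet)
       ++ₚ there (proj₁ Fᵥ-facet) (inj₂ v⊆Fᵥ) (here v∈X))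

proposition8 : ∀ {n} (X : SSet n) (d : ℕ) → 1 ≤ d → IsPseudomanifold d X →
    (IsNormal d X ⇔
      (∀ (x : Subset n) (p : ℕ) → x ∈ₛ X → ∣ x ∣ ≡ suc p → p + 2 ≤ d →
        IsPseudomanifold′ (link x X)))
proposition8 X d 1≤d pm@(cx , pure , _ , sc) = mk⇔
  (λ (_ , _ , _ , normal) → normal⇒linksArePseudomanifolds pm normal)
  (λ links → pm , stronglyConnected⇒connected sc , 1≤d ,
     facetsStronglyJoinedInStars⇒openSetsStronglyConnected pure
       (linksArePseudomanifolds⇒facetsStronglyJoinedInStars cx pure links))
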